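{- Let $0<p,\alpha<1$ and $\zeta=\min\{\frac p4,\frac\alpha4\}$. There exist $n_0$, $\epsilon>0$ and $\mu>0$ such that if $H$ is an $(n,p,\mu,\alpha)$ $3$-graph with $n\ge n_0$, then for every $\zeta$-separable $4$-set $B\subseteq V(H)$ there are at least $\epsilon n^4$ sets $A\subseteq V(H)$ with $|A|=4$ which $K_{1,1,2}$-absorb $B$ (that is, $H$ is $(4,\mathcal{B}_{\zeta,4},\epsilon,K_{1,1,2})$-rich).
   Context: A $3$-graph $H$ is a set of $3$-element subsets (edges) of a vertex set $V(H)$, $n=|V(H)|$. For $X_1,X_2,X_3\subseteq V(H)$, $e(X_1,X_2,X_3)$ counts $(x_1,x_2,x_3)\in X_1\times X_2\times X_3$ with $\{x_1,x_2,x_3\}\in H$. An $(n,p,\mu,\alpha)$ $3$-graph is an $n$-vertex $3$-graph with $e(X_1,X_2,X_3)\ge p|X_1||X_2||X_3|-\mu n^3$ for all $X_i\subseteq V(H)$ and every vertex in at least $\alpha\binom n2$ edges. $K_{1,1,2}$ (the cherry) is the $3$-graph of two edges sharing exactly two vertices. For a pair $S$, $d_H(S)$ is the number of edges containing $S$; a set of even size is $\zeta$-separable if it can be partitioned into pairs each with $d_H\ge\zeta n$, and $\mathcal{B}_{\zeta,b}$ is the family of $\zeta$-separable $b$-subsets. $A$ $F$-absorbs $B$ if both $H[A]$ and $H[A\cup B]$ can be partitioned into vertex sets each spanning a copy of $F$.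
   Formalization: The parameters p and α range over the rationals in (0,1) rather than the reals, and the witnesses ε and μ are taken in the rationals. -}

module Defs where

open import Data.Bool using (Bool; true; false; _∧_; if_then_else_)
open import Data.Nat as ℕ using (ℕ; _^_)
open import Data.Nat.Combinatorics using (_C_)
open import Data.Fin as Fin using (Fin; _<?_)
open import Data.Fin.Subset using (Subset; _∪_; ∣_∣) renaming (_∈_ to _∈ₛ_)
open import Data.Vec using (lookup)
open import Data.List using (List; []; _∷_; _++_; allFin; map; concatMap; length)
open import Data.Nat.ListAction using (sum)
open import Data.List.Membership.Propositional using () renaming (_∈_ to _∈ₗ_)
open import Data.List.Relation.Unary.All using (All)
open import Data.List.Relation.Unary.Unique.Propositional using (Unique)
open import Data.Integer using (+_)
open import Data.Rational using (ℚ; _/_; _*_; _-_; _≤_; _⊓_)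
open import Data.Product using (_×_; _,_; ∃; ∃-syntax)
open import Function.Bundles using (_⇔_)
open import Relation.Nullary.Decidable using (⌊_⌋)
open import Relation.Binary.PropositionalEquality using (_≡_)

toℚ : ℕ → ℚ
toℚ m = + m / 1

-- a 3-graph on vertex set Fin n: a symmetric Bool-valued predicate on triples,
-- false whenever two entries coincide (so it encodes a set of 3-element subsets)
record ThreeGraph (n : ℕ) : Set where
  field
    edge   : Fin n → Fin n → Fin n → Bool
    sym₁₂  : ∀ x y z → edge x y z ≡ edge y x z
    sym₂₃  : ∀ x y z → edge x y z ≡ edge x z y
    irrefl : ∀ x z → edge x x z ≡ false
open ThreeGraph public

sumF : ∀ {n} → (Fin n → ℕ) → ℕ
sumF {n} f = sum (map f (allFin n))

count : ∀ {n} → (Fin n → Bool) → ℕ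
count f = sumF (λ x → if f x then 1 else 0)

e : ∀ {n} → ThreeGraph n → Subset n → Subset n → Subset n → ℕ
e H X₁ X₂ X₃ =
  sumF (λ x → sumF (λ y → count (λ z →
    lookup X₁ x ∧ lookup X₂ y ∧ lookup X₃ z ∧ edge H x y z)))

deg : ∀ {n} → ThreeGraph n → Fin n → ℕ
deg H v = sumF (λ y → count (λ z → ⌊ y <? z ⌋ ∧ edge H v y z))

codeg : ∀ {n} → ThreeGraph n → Fin n → Fin n → ℕ
codeg H x y = count (λ z → edge H x y z)

IsQuasiRandom : ∀ {n} → ThreeGraph n → ℚ → ℚ → ℚ → Set
IsQuasiRandom {n} H p μ α =
  (∀ (X₁ X₂ X₃ : Subset n) →
     p * toℚ (∣ X₁ ∣ ℕ.* ∣ X₂ ∣ ℕ.* ∣ X₃ ∣) - μ * toℚ (n ^ 3) ≤ toℚ (e H X₁ X₂ X₃))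
  × (∀ (v : Fin n) → α * toℚ (n C 2) ≤ toℚ (deg H v))

pairVerts : ∀ {n} → List (Fin n × Fin n) → List (Fin n)
pairVerts = concatMap (λ { (x , y) → x ∷ y ∷ [] })

Separable : ∀ {n} → ThreeGraph n → ℚ → Subset n → Set
Separable {n} H ζ S = ∃[ ps ]
  Unique (pairVerts ps)
  × (∀ x → (x ∈ₛ S) ⇔ (x ∈ₗ pairVerts ps))
  × All (λ { (x , y) → ζ * toℚ n ≤ toℚ (codeg H x y) }) ps

Quad : ℕ → Set
Quad n = Fin n × Fin n × Fin n × Fin n

quadVerts : ∀ {n} → List (Quad n) → List (Fin n)
quadVerts = concatMap (λ { (a , b , c , d) → a ∷ b ∷ c ∷ d ∷ [] })

-- the 4 distinct vertices a,b,c,d span a copy of K_{1,1,2}: edges {a,b,c},{a,b,d}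
-- (distinctness is enforced by Unique in the tiling below)
Cherry : ∀ {n} → ThreeGraph n → Quad n → Set
Cherry H (a , b , c , d) = (edge H a b c ≡ true) × (edge H a b d ≡ true)

K112Tileable : ∀ {n} → ThreeGraph n → Subset n → Set
K112Tileable {n} H S = ∃[ qs ]
  Unique (quadVerts qs)
  × (∀ x → (x ∈ₛ S) ⇔ (x ∈ₗ quadVerts qs))
  × All (Cherry H) qs

Absorbs : ∀ {n} → ThreeGraph n → Subset n → Subset n → Set
Absorbs H A B = K112Tileable H A × K112Tileable H (A ∪ B)

ManyAbsorbers : ∀ {n} → ThreeGraph n → ℚ → Subset n → Set
ManyAbsorbers {n} H ε B = ∃[ As ]
  Unique As
  × All (λ A → (∣ A ∣ ≡ 4) × Absorbs H A B) As
  × (ε * toℚ (n ^ 4) ≤ toℚ (length As))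

module Submission where

-- Write B = {x₁, y₁} ∪ {x₂, y₂} with both pairs of codegree at least ζn, and let S and T be the links
-- of x₁y₁ and x₂y₂ outside B.  If a, b ∈ S, c ≠ d ∈ T and abc, abd are edges, then {a, b, c, d} spans a
-- cherry and B ∪ {a, b, c, d} splits into the cherries x₁y₁ab and x₂y₂cd, so {a, b, c, d} absorbs B.
-- A spine ab with h = |N(ab) ∩ T| has h² − h ≥ 2th − h − t² choices of (c, d), so there are at least
-- (2t − 1)·e(S, S, T) − t²|S|² such quadruples; quasirandomness bounds e(S, S, T) below by
-- p|S|²|T| − μn³, and with t a constant fraction of n this is of order n⁴.  Each 4-set arises from at
-- most 4⁴ quadruples.

open import Defs
open import Data.Nat using (ℕ)

module Sums where

  open import Data.Bool using (Bool; true; false; _∧_; if_then_else_)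
  open import Data.Fin using (Fin)
  open import Data.Fin.Properties using () renaming (_≟_ to _≟ᶠ_)
  open import Data.List using (List; []; _∷_; _++_; map; length; allFin; cartesianProduct)
  open import Data.List.Properties using (map-++; map-∘; length-tabulate)
  open import Data.List.Membership.Propositional using (_∈_)
  open import Data.List.Membership.Propositional.Properties using (∈-allFin)
  open import Data.List.Relation.Unary.Any using (here; there)
  open import Data.List.Relation.Unary.All using (All; []; _∷_)
  import Data.List.Relation.Unary.All as All
  open import Data.List.Relation.Unary.Unique.Propositional using (Unique; []; _∷_)
  open import Data.List.Relation.Unary.Unique.Propositional.Properties using (allFin⁺)
  open import Data.Nat
  open import Data.Nat.Properties
  open import Algebra.Properties.CommutativeSemigroup +-commutativeSemigroup using (interchange)
  open import Data.Nat.ListAction using (sum)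
  open import Data.Nat.ListAction.Properties using (sum-++)
  open import Data.Product using (_×_; _,_)
  open import Function using (id; _∘_)
  open import Relation.Binary.Definitions using (DecidableEquality)
  open import Relation.Binary.PropositionalEquality
  open import Relation.Nullary using (yes; no; does; contradiction)

  ∑ : {A : Set} → List A → (A → ℕ) → ℕ
  ∑ xs f = sum (map f xs)

  syntax ∑ xs (λ x → e) = ∑[ x ∈ xs ] e

  module _ {A : Set} where

    ∑-cong : ∀ {f g : A → ℕ} xs → (∀ x → f x ≡ g x) → ∑ xs f ≡ ∑ xs g
    ∑-cong []       f≗g = refl
    ∑-cong (x ∷ xs) f≗g = cong₂ _+_ (f≗g x) (∑-cong xs f≗g)

    ∑-mono-∈ : ∀ {f g : A → ℕ} xs → (∀ x → x ∈ xs → f x ≤ g x) → ∑ xs f ≤ ∑ xs g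
    ∑-mono-∈ []       f≤g = z≤n
    ∑-mono-∈ (x ∷ xs) f≤g = +-mono-≤ (f≤g x (here refl)) (∑-mono-∈ xs (λ y y∈xs → f≤g y (there y∈xs)))

    ∑-mono : ∀ {f g : A → ℕ} xs → (∀ x → f x ≤ g x) → ∑ xs f ≤ ∑ xs g
    ∑-mono xs f≤g = ∑-mono-∈ xs (λ x _ → f≤g x)

    ∑-+ : ∀ (f g : A → ℕ) xs → ∑[ x ∈ xs ] (f x + g x) ≡ ∑ xs f + ∑ xs g
    ∑-+ f g []       = refl
    ∑-+ f g (x ∷ xs) rewrite ∑-+ f g xs = interchange (f x) (g x) (∑ xs f) (∑ xs g)

    ∑-*ˡ : ∀ k (f : A → ℕ) xs → ∑[ x ∈ xs ] (k * f x) ≡ k * ∑ xs f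
    ∑-*ˡ k f []       = sym (*-zeroʳ k)
    ∑-*ˡ k f (x ∷ xs) rewrite ∑-*ˡ k f xs = sym (*-distribˡ-+ k (f x) (∑ xs f))

    ∑-*ʳ : ∀ k (f : A → ℕ) xs → ∑[ x ∈ xs ] (f x * k) ≡ ∑ xs f * k
    ∑-*ʳ k f xs = trans (∑-cong xs (λ x → *-comm (f x) k)) (trans (∑-*ˡ k f xs) (*-comm k _))

    ∑-const : ∀ k (xs : List A) → ∑[ _ ∈ xs ] k ≡ length xs * k
    ∑-const k []       = refl
    ∑-const k (x ∷ xs) = cong (k +_) (∑-const k xs)

    ∑-1≡length : (xs : List A) → ∑[ _ ∈ xs ] 1 ≡ length xs
    ∑-1≡length xs = trans (∑-const 1 xs) (*-identityʳ (length xs))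

    ∑-++ : ∀ (f : A → ℕ) xs ys → ∑ (xs ++ ys) f ≡ ∑ xs f + ∑ ys f
    ∑-++ f xs ys = trans (cong sum (map-++ f xs ys)) (sum-++ (map f xs) (map f ys))

  ∑-map : ∀ {A B : Set} (f : B → ℕ) (g : A → B) xs → ∑ (map g xs) f ≡ ∑ xs (f ∘ g)
  ∑-map f g xs = cong sum (sym (map-∘ xs))

  ∑-cartesianProduct : ∀ {A B : Set} (f : A × B → ℕ) xs ys →
    ∑ (cartesianProduct xs ys) f ≡ ∑[ x ∈ xs ] ∑[ y ∈ ys ] f (x , y)
  ∑-cartesianProduct f []       ys = refl
  ∑-cartesianProduct f (x ∷ xs) ys = trans (∑-++ f (map (x ,_) ys) _)
    (cong₂ _+_ (∑-map f (x ,_) ys) (∑-cartesianProduct f xs ys))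

  ∑-comm : ∀ {A B : Set} (f : A → B → ℕ) xs ys →
    ∑[ x ∈ xs ] ∑[ y ∈ ys ] f x y ≡ ∑[ y ∈ ys ] ∑[ x ∈ xs ] f x y
  ∑-comm f []       ys = sym (trans (∑-const 0 ys) (*-zeroʳ (length ys)))
  ∑-comm f (x ∷ xs) ys = trans (cong (∑ ys (f x) +_) (∑-comm f xs ys)) (sym (∑-+ (f x) _ ys))

  ∑² : {A : Set} → List A → (A → A → ℕ) → ℕ
  ∑² xs f = ∑[ x ∈ xs ] ∑[ y ∈ xs ] f x y

  syntax ∑² xs (λ x y → e) = ∑²[ x , y ∈ xs ] e

  module _ {A : Set} (xs : List A) where

    ∑²-cong : ∀ {f g : A → A → ℕ} → (∀ x y → f x y ≡ g x y) → ∑² xs f ≡ ∑² xs g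
    ∑²-cong f≗g = ∑-cong xs (λ x → ∑-cong xs (f≗g x))

    ∑²-mono : ∀ {f g : A → A → ℕ} → (∀ x y → f x y ≤ g x y) → ∑² xs f ≤ ∑² xs g
    ∑²-mono f≤g = ∑-mono xs (λ x → ∑-mono xs (f≤g x))

    ∑²-+ : ∀ (f g : A → A → ℕ) → ∑²[ x , y ∈ xs ] (f x y + g x y) ≡ ∑² xs f + ∑² xs g
    ∑²-+ f g = trans (∑-cong xs (λ x → ∑-+ (f x) (g x) xs)) (∑-+ _ _ xs)

    ∑²-*ʳ : ∀ k (f : A → A → ℕ) → ∑²[ x , y ∈ xs ] (f x y * k) ≡ ∑² xs f * k
    ∑²-*ʳ k f = trans (∑-cong xs (λ x → ∑-*ʳ k (f x) xs)) (∑-*ʳ k _ xs)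

    ∑²-*ˡ : ∀ k (f : A → A → ℕ) → ∑²[ x , y ∈ xs ] (k * f x y) ≡ k * ∑² xs f
    ∑²-*ˡ k f = trans (∑-cong xs (λ x → ∑-*ˡ k (f x) xs)) (∑-*ˡ k _ xs)

  𝟙 : Bool → ℕ
  𝟙 b = if b then 1 else 0

  𝟙≤1 : ∀ b → 𝟙 b ≤ 1
  𝟙≤1 true  = s≤s z≤n
  𝟙≤1 false = z≤n

  𝟙-∧ : ∀ a b → 𝟙 (a ∧ b) ≡ 𝟙 a * 𝟙 b
  𝟙-∧ true  b = sym (+-identityʳ (𝟙 b))
  𝟙-∧ false b = refl

  module Kronecker {A : Set} (_≟_ : DecidableEquality A) where

    δ : A → A → ℕ
    δ x y = 𝟙 (does (x ≟ y))

    δ-refl : ∀ x → δ x x ≡ 1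
    δ-refl x with x ≟ x
    ... | yes _   = refl
    ... | no x≢x = contradiction refl x≢x

    δ-sym : ∀ x y → δ x y ≡ δ y x
    δ-sym x y with x ≟ y | y ≟ x
    ... | yes _   | yes _   = refl
    ... | no _    | no _    = refl
    ... | yes x≡y | no y≢x = contradiction (sym x≡y) y≢x
    ... | no x≢y  | yes y≡x = contradiction (sym y≡x) x≢y

    ∑δ≡0 : ∀ {y} xs → All (_≢ y) xs → ∑[ x ∈ xs ] δ x y ≡ 0
    ∑δ≡0 []       []          = refl
    ∑δ≡0 {y} (x ∷ xs) (x≢y ∷ xs≢y) with x ≟ y
    ... | yes x≡y = contradiction x≡y x≢y
    ... | no _    = ∑δ≡0 xs xs≢y

    ∑δ≤1 : ∀ {y} xs → Unique xs → ∑[ x ∈ xs ] δ x y ≤ 1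
    ∑δ≤1 []       []          = z≤n
    ∑δ≤1 {y} (x ∷ xs) (x∉xs ∷ u) with x ≟ y
    ... | yes refl = ≤-reflexive (cong suc (∑δ≡0 xs (All.map ≢-sym x∉xs)))
    ... | no _     = ∑δ≤1 xs u

    1≤∑δ : ∀ {y} xs → y ∈ xs → 1 ≤ ∑[ x ∈ xs ] δ y x
    1≤∑δ (x ∷ xs) (here refl) = ≤-trans (≤-reflexive (sym (δ-refl x))) (m≤m+n _ _)
    1≤∑δ (x ∷ xs) (there y∈xs) = ≤-trans (1≤∑δ xs y∈xs) (m≤n+m _ _)

    ∑δ≡1 : ∀ {y} xs → Unique xs → y ∈ xs → ∑[ x ∈ xs ] δ x y ≡ 1
    ∑δ≡1 {y} xs u y∈xs = ≤-antisym (∑δ≤1 xs u)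
      (≤-trans (1≤∑δ xs y∈xs) (≤-reflexive (∑-cong xs (δ-sym y))))

  open Kronecker public

  ∑-δ-allFin : ∀ {n} (y : Fin n) → ∑[ x ∈ allFin n ] δ _≟ᶠ_ y x ≡ 1
  ∑-δ-allFin {n} y = trans (∑-cong (allFin n) (δ-sym _≟ᶠ_ y)) (∑δ≡1 _≟ᶠ_ (allFin n) (allFin⁺ n) (∈-allFin y))

  count≤n : ∀ {n} (P : Fin n → Bool) → count P ≤ n
  count≤n {n} P = ≤-trans (∑-mono (allFin n) (𝟙≤1 ∘ P))
    (≤-reflexive (trans (∑-1≡length (allFin n)) (length-tabulate id)))

module Subsets where

  open import Data.Bool using (Bool; true; false)
  open import Data.Fin using (Fin; zero; suc)
  open import Data.Fin.Properties using () renaming (_≟_ to _≟ᶠ_)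
  open import Data.Fin.Subset using (Subset; ∣_∣) renaming (_∈_ to _∈ₛ_)
  open import Data.List using (List; []; _∷_; length; allFin; map)
  open import Data.List.Properties using (map-tabulate)
  open import Data.List.Membership.Propositional using (_∈_; _∉_)
  import Data.List.Relation.Unary.All as All
  open import Data.List.Relation.Unary.All.Properties using (¬Any⇒All¬)
  open import Data.List.Relation.Unary.Unique.Propositional using (Unique)
  open import Data.Nat using (ℕ; suc; _+_)
  open import Data.Nat.ListAction using (sum)
  open import Data.Vec using (Vec; lookup; tabulate)
  open import Data.Vec.Properties using ([]=⇒lookup; lookup⇒[]=; lookup∘tabulate)
  open import Function using (id; _∘_; _⇔_; mk⇔; Equivalence)
  open import Relation.Binary.PropositionalEquality
  open import Relation.Nullary using (yes; no; does)
  open import Relation.Nullary.Decidable using (dec-true)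
  open Sums

  ∈ₛ⇔lookup : ∀ {n} {S : Subset n} {x} → x ∈ₛ S ⇔ lookup S x ≡ true
  ∈ₛ⇔lookup {S = S} {x} = mk⇔ []=⇒lookup (lookup⇒[]= x S)

  ∑-allFin-suc : ∀ {n} (f : Fin (suc n) → ℕ) → ∑ (allFin (suc n)) f ≡ f zero + ∑ (allFin n) (f ∘ suc)
  ∑-allFin-suc {n} f = cong (f zero +_) (cong sum
    (trans (map-tabulate {n = n} suc f) (sym (map-tabulate {n = n} id (f ∘ suc)))))

  ∣∣≡count : ∀ {n} (S : Subset n) → ∣ S ∣ ≡ count (lookup S)
  ∣∣≡count Vec.[]        = refl
  ∣∣≡count (true  Vec.∷ S) = trans (cong suc (∣∣≡count S)) (sym (∑-allFin-suc (𝟙 ∘ lookup (true Vec.∷ S))))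
  ∣∣≡count (false Vec.∷ S) = trans (∣∣≡count S) (sym (∑-allFin-suc (𝟙 ∘ lookup (false Vec.∷ S))))

  ∣tabulate∣≡count : ∀ {n} (f : Fin n → Bool) → ∣ tabulate f ∣ ≡ count f
  ∣tabulate∣≡count {n} f = trans (∣∣≡count (tabulate f)) (∑-cong (allFin n) (cong 𝟙 ∘ lookup∘tabulate f))

  module _ {n : ℕ} where

    open import Data.List.Membership.DecPropositional (_≟ᶠ_ {n}) using (_∈?_)

    module _ {S : Subset n} {L : List (Fin n)} (u : Unique L) (S⇔L : ∀ x → x ∈ₛ S ⇔ x ∈ L) where

      𝟙-lookup≡∑δ : ∀ x → 𝟙 (lookup S x) ≡ ∑[ l ∈ L ] δ _≟ᶠ_ l x
      𝟙-lookup≡∑δ x with lookup S x in eq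
      ... | true  = sym (∑δ≡1 _≟ᶠ_ L u (Equivalence.to (S⇔L x) (Equivalence.from ∈ₛ⇔lookup eq)))
      ... | false = sym (∑δ≡0 _≟ᶠ_ L (All.map ≢-sym (¬Any⇒All¬ L x∉L)))
        where
        x∉L : x ∉ L
        x∉L x∈L with () ← trans (sym eq) (Equivalence.to ∈ₛ⇔lookup (Equivalence.from (S⇔L x) x∈L))

      ∣∣≡length : ∣ S ∣ ≡ length L
      ∣∣≡length = begin
        ∣ S ∣                                           ≡⟨ ∣∣≡count S ⟩
        ∑[ x ∈ allFin n ] 𝟙 (lookup S x)                ≡⟨ ∑-cong (allFin n) 𝟙-lookup≡∑δ ⟩
        ∑[ x ∈ allFin n ] ∑[ l ∈ L ] δ _≟ᶠ_ l x         ≡⟨ ∑-comm (λ x l → δ _≟ᶠ_ l x) (allFin n) L ⟩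
        ∑[ l ∈ L ] ∑[ x ∈ allFin n ] δ _≟ᶠ_ l x         ≡⟨ ∑-cong L ∑-δ-allFin ⟩
        ∑[ l ∈ L ] 1                                    ≡⟨ ∑-1≡length L ⟩
        length L                                        ∎
        where open ≡-Reasoning

    fromList : List (Fin n) → Subset n
    fromList L = tabulate (λ x → does (x ∈? L))

    ∈-fromList : ∀ (L : List (Fin n)) x → x ∈ₛ fromList L ⇔ x ∈ L
    ∈-fromList L x = mk⇔
      (λ x∈ₛ → from-does (trans (sym (lookup∘tabulate _ x)) (Equivalence.to ∈ₛ⇔lookup x∈ₛ)))
      (λ x∈L → Equivalence.from ∈ₛ⇔lookup (trans (lookup∘tabulate _ x) (dec-true (x ∈? L) x∈L)))
      where
      from-does : does (x ∈? L) ≡ true → x ∈ L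
      from-does eq with x ∈? L
      ... | yes x∈L = x∈L
      from-does () | no _

module Counting where

  open import Data.Bool using (Bool; true; false; _∧_; not)
  open import Data.Bool.Properties using (∧-assoc)
  open import Data.Fin using (Fin)
  open import Data.Fin.Properties using () renaming (_≟_ to _≟ᶠ_)
  open import Data.Fin.Subset using (Subset; ∣_∣)
  open import Data.List using (List; []; _∷_; map; length; allFin; cartesianProduct; filterᵇ; deduplicate)
  open import Data.List.Membership.Propositional using (_∈_)
  open import Data.List.Membership.Propositional.Properties
    using (∈-cartesianProduct⁺; ∈-map⁺; ∈-map⁻; ∈-deduplicate⁺; ∈-deduplicate⁻)
  open import Data.List.Relation.Unary.Unique.Propositional using (Unique)
  open import Data.List.Relation.Unary.Unique.Propositional.Properties using (allFin⁺; cartesianProduct⁺; filter⁺)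
  open import Data.Nat
  open import Data.Nat.Properties
  open import Data.Nat.Tactic.RingSolver using (solve)
  open import Data.List.Properties using (length-tabulate)
  open import Data.Product using (_×_; _,_)
  open import Data.Sum using ([_,_]′)
  open import Data.Vec using (lookup)
  open import Function using (id; _∘_)
  open import Relation.Binary.Definitions using (DecidableEquality)
  open import Relation.Binary.PropositionalEquality
  open import Relation.Nullary using (yes; no; does)
  open import Relation.Nullary.Decidable using (T?)
  open Sums
  open Subsets using (∣∣≡count)

  2*m*n≤m*m+n*n : ∀ m n → 2 * m * n ≤ m * m + n * n
  2*m*n≤m*m+n*n m n = [ ordered , swapped ]′ (≤-total m n)
    where
    ordered : ∀ {m n} → m ≤ n → 2 * m * n ≤ m * m + n * n
    ordered {m} {n} m≤n = subst (λ n → 2 * m * n ≤ m * m + n * n) (m+[n∸m]≡n m≤n) (gap m (n ∸ m))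
      where
      gap : ∀ m k → 2 * m * (m + k) ≤ m * m + (m + k) * (m + k)
      gap m k = begin
        2 * m * (m + k)            ≤⟨ m≤m+n _ (k * k) ⟩
        2 * m * (m + k) + k * k    ≡⟨ solve (m ∷ k ∷ []) ⟩
        m * m + (m + k) * (m + k)  ∎
        where open ≤-Reasoning
    swapped : n ≤ m → 2 * m * n ≤ m * m + n * n
    swapped n≤m = begin
      2 * m * n      ≡⟨ solve (m ∷ n ∷ []) ⟩
      2 * n * m      ≤⟨ ordered n≤m ⟩
      n * n + m * m  ≡⟨ +-comm (n * n) (m * m) ⟩
      m * m + n * n  ∎
      where open ≤-Reasoning

  module _ {n : ℕ} where

    distinctPairs : (Fin n → Bool) → ℕ
    distinctPairs P = ∑²[ c , d ∈ allFin n ] 𝟙 (P c ∧ (P d ∧ not (does (c ≟ᶠ d))))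

    distinctPairs+count≡count² : ∀ P → distinctPairs P + count P ≡ count P * count P
    distinctPairs+count≡count² P = begin
      distinctPairs P + count P
        ≡⟨ cong (distinctPairs P +_) (∑-cong V (λ c → trans (sym (*-identityʳ (𝟙 (P c))))
             (cong (𝟙 (P c) *_) (sym (∑-δ-allFin c))))) ⟩
      distinctPairs P + ∑[ c ∈ V ] (𝟙 (P c) * ∑[ d ∈ V ] δ _≟ᶠ_ c d)
        ≡⟨ cong (distinctPairs P +_) (∑-cong V (λ c → sym (∑-*ˡ (𝟙 (P c)) (δ _≟ᶠ_ c) V))) ⟩
      distinctPairs P + ∑²[ c , d ∈ V ] (𝟙 (P c) * δ _≟ᶠ_ c d)
        ≡⟨ sym (∑²-+ V _ _) ⟩
      ∑²[ c , d ∈ V ] (𝟙 (P c ∧ (P d ∧ not (does (c ≟ᶠ d)))) + 𝟙 (P c) * δ _≟ᶠ_ c d)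
        ≡⟨ ∑²-cong V split ⟩
      ∑²[ c , d ∈ V ] (𝟙 (P c) * 𝟙 (P d))
        ≡⟨ ∑-cong V (λ c → ∑-*ˡ (𝟙 (P c)) (𝟙 ∘ P) V) ⟩
      ∑[ c ∈ V ] (𝟙 (P c) * count P)
        ≡⟨ ∑-*ʳ (count P) (𝟙 ∘ P) V ⟩
      count P * count P ∎
      where
      open ≡-Reasoning
      V = allFin n
      split : ∀ c d → 𝟙 (P c ∧ (P d ∧ not (does (c ≟ᶠ d)))) + 𝟙 (P c) * δ _≟ᶠ_ c d ≡ 𝟙 (P c) * 𝟙 (P d)
      split c d with c ≟ᶠ d
      ... | yes refl with P c
      ...   | true  = refl
      ...   | false = refl
      split c d | no _ with P c | P d
      ...   | true  | true  = refl
      ...   | true  | false = refl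
      ...   | false | _     = refl

  module _ {A : Set} where

    quadruples : List A → List (A × A × A × A)
    quadruples xs = cartesianProduct xs (cartesianProduct xs (cartesianProduct xs xs))

    quadruples⁺ : ∀ {xs} → Unique xs → Unique (quadruples xs)
    quadruples⁺ u = cartesianProduct⁺ u (cartesianProduct⁺ u (cartesianProduct⁺ u u))

    ∈-quadruples⁺ : ∀ {xs a b c d} → a ∈ xs → b ∈ xs → c ∈ xs → d ∈ xs → (a , b , c , d) ∈ quadruples xs
    ∈-quadruples⁺ a∈ b∈ c∈ d∈ = ∈-cartesianProduct⁺ a∈ (∈-cartesianProduct⁺ b∈ (∈-cartesianProduct⁺ c∈ d∈))

    ∑-quadruples : ∀ (f : A × A × A × A → ℕ) xs →
      ∑ (quadruples xs) f ≡ ∑[ a ∈ xs ] ∑[ b ∈ xs ] ∑[ c ∈ xs ] ∑[ d ∈ xs ] f (a , b , c , d)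
    ∑-quadruples f xs = trans (∑-cartesianProduct f xs _) (∑-cong xs λ a →
      trans (∑-cartesianProduct _ xs _) (∑-cong xs λ b → ∑-cartesianProduct _ xs xs))

    length-filterᵇ : ∀ (p : A → Bool) xs → length (filterᵇ p xs) ≡ ∑[ x ∈ xs ] 𝟙 (p x)
    length-filterᵇ p []       = refl
    length-filterᵇ p (x ∷ xs) with p x
    ... | true  = cong suc (length-filterᵇ p xs)
    ... | false = length-filterᵇ p xs

  module CherryCount {n : ℕ} (H : ThreeGraph n) (S T : Subset n) where

    private
      V = allFin n

    completes : Fin n → Fin n → Fin n → Bool
    completes a b v = lookup T v ∧ edge H a b v

    spine : Fin n → Fin n → Bool
    spine a b = lookup S a ∧ lookup S b

    isCherry : Quad n → Bool
    isCherry (a , b , c , d) = spine a b ∧ (completes a b c ∧ (completes a b d ∧ not (does (c ≟ᶠ d))))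

    cherries : List (Quad n)
    cherries = filterᵇ isCherry (quadruples V)

    cherries-unique : Unique cherries
    cherries-unique = filter⁺ (T? ∘ isCherry) (quadruples⁺ (allFin⁺ n))

    edgesSST : ℕ
    edgesSST = ∑²[ a , b ∈ V ] (𝟙 (spine a b) * count (completes a b))

    e≡edgesSST : e H S S T ≡ edgesSST
    e≡edgesSST = ∑²-cong V λ a b → trans
      (∑-cong V λ c → trans (cong 𝟙 (sym (∧-assoc (lookup S a) (lookup S b) (completes a b c))))
                            (𝟙-∧ (spine a b) (completes a b c)))
      (∑-*ˡ (𝟙 (spine a b)) (𝟙 ∘ completes a b) V)

    edgesSST≤n³ : edgesSST ≤ n ^ 3
    edgesSST≤n³ = begin
      edgesSST                         ≤⟨ ∑²-mono V (λ a b → *-mono-≤ (𝟙≤1 (spine a b)) (count≤n (completes a b))) ⟩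
      ∑²[ a , b ∈ V ] (1 * n)          ≡⟨ ∑-cong V (λ _ → ∑-const (1 * n) V) ⟩
      ∑[ a ∈ V ] (length V * (1 * n))  ≡⟨ ∑-const _ V ⟩
      length V * (length V * (1 * n))  ≡⟨ cong (λ m → m * (m * (1 * n))) (length-tabulate {n = n} id) ⟩
      n * (n * (1 * n))                ≡⟨ solve (n ∷ []) ⟩
      n * (n * (n * 1))                ∎
      where open ≤-Reasoning

    ∑²-spine : ∑²[ a , b ∈ V ] 𝟙 (spine a b) ≡ ∣ S ∣ * ∣ S ∣
    ∑²-spine = begin
      ∑²[ a , b ∈ V ] 𝟙 (spine a b)                        ≡⟨ ∑²-cong V (λ a b → 𝟙-∧ (lookup S a) (lookup S b)) ⟩
      ∑²[ a , b ∈ V ] (𝟙 (lookup S a) * 𝟙 (lookup S b))    ≡⟨ ∑-cong V (λ a → ∑-*ˡ (𝟙 (lookup S a)) (𝟙 ∘ lookup S) V) ⟩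
      ∑[ a ∈ V ] (𝟙 (lookup S a) * count (lookup S))       ≡⟨ ∑-*ʳ _ (𝟙 ∘ lookup S) V ⟩
      count (lookup S) * count (lookup S)                  ≡⟨ cong (λ m → m * m) (sym (∣∣≡count S)) ⟩
      ∣ S ∣ * ∣ S ∣                                        ∎
      where open ≡-Reasoning

    length-cherries : length cherries ≡ ∑²[ a , b ∈ V ] (𝟙 (spine a b) * distinctPairs (completes a b))
    length-cherries = begin
      length cherries                          ≡⟨ length-filterᵇ isCherry (quadruples V) ⟩
      ∑[ q ∈ quadruples V ] 𝟙 (isCherry q)     ≡⟨ ∑-quadruples (𝟙 ∘ isCherry) V ⟩
      ∑²[ a , b ∈ V ] ∑²[ c , d ∈ V ] 𝟙 (isCherry (a , b , c , d))
        ≡⟨ ∑²-cong V (λ a b → trans (∑²-cong V (λ c d → 𝟙-∧ (spine a b) _)) (∑²-*ˡ V (𝟙 (spine a b)) _)) ⟩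
      ∑²[ a , b ∈ V ] (𝟙 (spine a b) * distinctPairs (completes a b)) ∎
      where open ≡-Reasoning

    cherry-count : ∀ t → 2 * t * edgesSST ≤ length cherries + edgesSST + t * t * (∣ S ∣ * ∣ S ∣)
    cherry-count t = begin
      2 * t * edgesSST
        ≡⟨ sym (∑²-*ˡ V (2 * t) _) ⟩
      ∑²[ a , b ∈ V ] (2 * t * (𝟙 (spine a b) * count (completes a b)))
        ≤⟨ ∑²-mono V (λ a b → pointwise (𝟙 (spine a b)) (distinctPairs+count≡count² (completes a b))) ⟩
      ∑²[ a , b ∈ V ] (𝟙 (spine a b) * distinctPairs (completes a b) + 𝟙 (spine a b) * count (completes a b)
                       + 𝟙 (spine a b) * (t * t))
        ≡⟨ trans (∑²-+ V _ _) (cong (_+ ∑²[ a , b ∈ V ] (𝟙 (spine a b) * (t * t))) (∑²-+ V _ _)) ⟩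
      ∑²[ a , b ∈ V ] (𝟙 (spine a b) * distinctPairs (completes a b)) + edgesSST
        + ∑²[ a , b ∈ V ] (𝟙 (spine a b) * (t * t))
        ≡⟨ cong₂ (λ L Y → L + edgesSST + Y) (sym length-cherries)
             (trans (∑²-*ʳ V (t * t) _) (trans (cong (_* (t * t)) ∑²-spine) (*-comm _ (t * t)))) ⟩
      length cherries + edgesSST + t * t * (∣ S ∣ * ∣ S ∣) ∎
      where
      open ≤-Reasoning
      pointwise : ∀ i {p h} → p + h ≡ h * h → 2 * t * (i * h) ≤ i * p + i * h + i * (t * t)
      pointwise i {p} {h} p+h≡h² = begin
        2 * t * (i * h)                  ≡⟨ solve (t ∷ i ∷ h ∷ []) ⟩
        i * (2 * t * h)                  ≤⟨ *-monoʳ-≤ i (2*m*n≤m*m+n*n t h) ⟩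
        i * (t * t + h * h)              ≡⟨ cong (λ m → i * (t * t + m)) (sym p+h≡h²) ⟩
        i * (t * t + (p + h))            ≡⟨ solve (t ∷ i ∷ p ∷ h ∷ []) ⟩
        i * p + i * h + i * (t * t)      ∎

  module _ {A C : Set} (_≟ᴬ_ : DecidableEquality A) (_≟ᶜ_ : DecidableEquality C) (f : A → C) where

    length≤images*k : ∀ (fibre : A → List A) k {xs} → Unique xs →
      (∀ x y → f x ≡ f y → x ∈ fibre y) → (∀ y → length (fibre y) ≤ k) →
      length xs ≤ length (deduplicate _≟ᶜ_ (map f xs)) * k
    length≤images*k fibre k {xs} u covers small = begin
      length xs                                     ≡⟨ sym (∑-1≡length xs) ⟩
      ∑[ x ∈ xs ] 1                                 ≤⟨ ∑-mono-∈ xs (λ x x∈xs → 1≤∑δ _≟ᶜ_ images (fx∈images x∈xs)) ⟩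
      ∑[ x ∈ xs ] ∑[ c ∈ images ] δ _≟ᶜ_ (f x) c    ≡⟨ ∑-comm (λ x c → δ _≟ᶜ_ (f x) c) xs images ⟩
      ∑[ c ∈ images ] ∑[ x ∈ xs ] δ _≟ᶜ_ (f x) c    ≤⟨ ∑-mono-∈ images fibre-size ⟩
      ∑[ _ ∈ images ] k                             ≡⟨ ∑-const k images ⟩
      length images * k                             ∎
      where
      open ≤-Reasoning
      images = deduplicate _≟ᶜ_ (map f xs)
      fx∈images : ∀ {x} → x ∈ xs → f x ∈ images
      fx∈images x∈xs = ∈-deduplicate⁺ _≟ᶜ_ (∈-map⁺ f x∈xs)
      fibre-size : ∀ c → c ∈ images → ∑[ x ∈ xs ] δ _≟ᶜ_ (f x) c ≤ k
      fibre-size c c∈images with ∈-map⁻ f (∈-deduplicate⁻ _≟ᶜ_ (map f xs) c∈images)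
      ... | y , _ , refl = begin
        ∑[ x ∈ xs ] δ _≟ᶜ_ (f x) (f y)              ≤⟨ ∑-mono xs δ≤∑δ ⟩
        ∑[ x ∈ xs ] ∑[ z ∈ fibre y ] δ _≟ᴬ_ x z     ≡⟨ ∑-comm (δ _≟ᴬ_) xs (fibre y) ⟩
        ∑[ z ∈ fibre y ] ∑[ x ∈ xs ] δ _≟ᴬ_ x z     ≤⟨ ∑-mono (fibre y) (λ z → ∑δ≤1 _≟ᴬ_ xs u) ⟩
        ∑[ _ ∈ fibre y ] 1                          ≡⟨ ∑-1≡length (fibre y) ⟩
        length (fibre y)                            ≤⟨ small y ⟩
        k                                           ∎
        where
        δ≤∑δ : ∀ x → δ _≟ᶜ_ (f x) (f y) ≤ ∑[ z ∈ fibre y ] δ _≟ᴬ_ x z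
        δ≤∑δ x with f x ≟ᶜ f y
        ... | yes fx≡fy = 1≤∑δ _≟ᴬ_ (fibre y) (covers x y fx≡fy)
        ... | no _      = z≤n

module Absorption {n : ℕ} (H : ThreeGraph n) where

  open import Data.Bool using (true; false; _∧_; not)
  open import Data.Bool.Properties using (∧-conicalˡ; ∧-conicalʳ; not-injective; T-≡)
  import Data.Bool.Properties as Bool
  open import Data.Fin using (Fin)
  open import Data.Fin.Properties using (_≟_)
  open import Data.Fin.Subset using (Subset; _∪_; ∣_∣) renaming (_∈_ to _∈ₛ_; _∉_ to _∉ₛ_)
  open import Data.Fin.Subset.Properties using (x∈p∪q⁻; x∈p∪q⁺)
  open import Data.List using (List; []; _∷_; _++_; map; length; deduplicate; allFin)
  open import Data.List.Membership.Propositional using (_∈_)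
  open import Data.List.Membership.Propositional.Properties
    using (∈-++⁺ˡ; ∈-++⁺ʳ; ∈-++⁻; ∈-filter⁻; ∈-map⁻; ∈-deduplicate⁻)
  open import Relation.Binary.PropositionalEquality
  open import Data.List.Relation.Binary.Permutation.Setoid (setoid (Fin n)) using (_↭_; ↭-prep; ↭-sym)
  open import Data.List.Relation.Binary.Permutation.Setoid.Properties (setoid (Fin n))
    using (shifts; ∈-resp-↭; Unique-resp-↭)
  open import Data.List.Relation.Unary.Any using (here; there)
  open import Data.List.Relation.Unary.All using (All; []; _∷_)
  import Data.List.Relation.Unary.All as All
  open import Data.List.Relation.Unary.Unique.Propositional using (Unique; []; _∷_)
  open import Data.List.Relation.Unary.Unique.Propositional.Properties using (++⁺)
  open import Data.Nat using (_+_; _≤_; z≤n; s≤s)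
  open import Data.Nat.Properties using (module ≤-Reasoning)
  open import Data.Product using (_×_; _,_; proj₁; proj₂)
  open import Data.Product.Properties using () renaming (≡-dec to ≡-decᵖ)
  open import Data.Sum using (inj₁; inj₂; [_,_]′)
  open import Data.Vec using (lookup; tabulate)
  open import Data.Vec.Properties using (lookup∘tabulate) renaming (≡-dec to ≡-decᵛ)
  open import Function using (_∘_; _⇔_; mk⇔; Equivalence; case_of_)
  open import Relation.Binary.Definitions using (DecidableEquality)
  open import Relation.Nullary using (does)
  open import Relation.Nullary.Decidable using (T?; dec-true)
  open Sums using (𝟙; ∑; ∑-mono; ∑-+)
  open Subsets using (∈ₛ⇔lookup; ∣∣≡count; ∣∣≡length; ∣tabulate∣≡count; fromList; ∈-fromList)
  open Counting using (module CherryCount; quadruples; ∈-quadruples⁺)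

  private
    false≢true : false ≢ true
    false≢true ()

    split-∧ : ∀ {a b} → a ∧ b ≡ true → a ≡ true × b ≡ true
    split-∧ a∧b = ∧-conicalˡ _ _ a∧b , ∧-conicalʳ _ _ a∧b

  _≟ₛ_ : DecidableEquality (Subset n)
  _≟ₛ_ = ≡-decᵛ Bool._≟_

  edge⇒≢ : ∀ {x y z} → edge H x y z ≡ true → x ≢ y × x ≢ z × y ≢ z
  edge⇒≢ {x} {y} {z} xyz =
      (λ { refl → false≢true (trans (sym (irrefl H x z)) xyz) })
    , (λ { refl → false≢true (trans (sym (irrefl H x y)) (trans (sym (sym₂₃ H x y x)) xyz)) })
    , (λ { refl → false≢true (trans (sym (irrefl H y x))
                   (trans (sym (sym₂₃ H y x y)) (trans (sym (sym₁₂ H x y y)) xyz))) })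

  _≟q_ : DecidableEquality (Quad n)
  _≟q_ = ≡-decᵖ _≟_ (≡-decᵖ _≟_ (≡-decᵖ _≟_ _≟_))

  quadVertices : Quad n → List (Fin n)
  quadVertices (a , b , c , d) = a ∷ b ∷ c ∷ d ∷ []

  quadSet : Quad n → Subset n
  quadSet q = fromList (quadVertices q)

  quadSet≡⇒∈quadruples : ∀ q q′ → quadSet q ≡ quadSet q′ → q ∈ quadruples (quadVertices q′)
  quadSet≡⇒∈quadruples (a , b , c , d) q′ eq = ∈-quadruples⁺ (move (here refl)) (move (there (here refl)))
    (move (there (there (here refl)))) (move (there (there (there (here refl)))))
    where
    move : ∀ {x} → x ∈ quadVertices (a , b , c , d) → x ∈ quadVertices q′
    move x∈ = Equivalence.to (∈-fromList _ _) (subst (_ ∈ₛ_) eq (Equivalence.from (∈-fromList _ _) x∈))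

  length-quadruples-quadVertices : ∀ q → length (quadruples (quadVertices q)) ≡ 256
  length-quadruples-quadVertices (a , b , c , d) = refl

  cherry-unique : ∀ {a b c d} → Cherry H (a , b , c , d) → c ≢ d → Unique (a ∷ b ∷ c ∷ d ∷ [])
  cherry-unique (abc , abd) c≢d with edge⇒≢ abc | edge⇒≢ abd
  ... | a≢b , a≢c , b≢c | _ , a≢d , b≢d = (a≢b ∷ a≢c ∷ a≢d ∷ []) ∷ (b≢c ∷ b≢d ∷ []) ∷ (c≢d ∷ []) ∷ [] ∷ []

  cherry-tileable : ∀ {a b c d} → Cherry H (a , b , c , d) → c ≢ d →
    ∣ quadSet (a , b , c , d) ∣ ≡ 4 × K112Tileable H (quadSet (a , b , c , d))
  cherry-tileable {a} {b} {c} {d} cherry c≢d =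
      ∣∣≡length (cherry-unique cherry c≢d) (∈-fromList (a ∷ b ∷ c ∷ d ∷ []))
    , ((a , b , c , d) ∷ []) , cherry-unique cherry c≢d , ∈-fromList (a ∷ b ∷ c ∷ d ∷ []) , cherry ∷ []

  absorbs : ∀ {B x₁ y₁ x₂ y₂ a b c d} →
    Unique (x₁ ∷ y₁ ∷ x₂ ∷ y₂ ∷ []) → (∀ x → x ∈ₛ B ⇔ x ∈ (x₁ ∷ y₁ ∷ x₂ ∷ y₂ ∷ [])) →
    All (_∉ₛ B) (a ∷ b ∷ c ∷ d ∷ []) → Cherry H (a , b , c , d) → c ≢ d →
    Cherry H (x₁ , y₁ , a , b) → Cherry H (x₂ , y₂ , c , d) →
    ∣ quadSet (a , b , c , d) ∣ ≡ 4 × Absorbs H (quadSet (a , b , c , d)) B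
  absorbs {B} {x₁} {y₁} {x₂} {y₂} {a} {b} {c} {d} uB B⇔ outsideB cherry c≢d cherry₁ cherry₂ =
      proj₁ tileA , proj₂ tileA
    , ((x₁ , y₁ , a , b) ∷ (x₂ , y₂ , c , d) ∷ []) , Unique-resp-↭ perm uBA , (λ x → mk⇔ (to x) (from x))
    , cherry₁ ∷ cherry₂ ∷ []
    where
    A = quadSet (a , b , c , d)
    aL = a ∷ b ∷ c ∷ d ∷ []
    bL = x₁ ∷ y₁ ∷ x₂ ∷ y₂ ∷ []
    tileA = cherry-tileable cherry c≢d
    uBA : Unique (bL ++ aL)
    uBA = ++⁺ uB (cherry-unique cherry c≢d)
      (λ (v∈bL , v∈aL) → All.lookup outsideB v∈aL (Equivalence.from (B⇔ _) v∈bL))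
    perm : bL ++ aL ↭ x₁ ∷ y₁ ∷ a ∷ b ∷ x₂ ∷ y₂ ∷ c ∷ d ∷ []
    perm = ↭-prep x₁ (↭-prep y₁ (shifts (x₂ ∷ y₂ ∷ []) (a ∷ b ∷ [])))
    to : ∀ x → x ∈ₛ A ∪ B → x ∈ x₁ ∷ y₁ ∷ a ∷ b ∷ x₂ ∷ y₂ ∷ c ∷ d ∷ []
    to x = ∈-resp-↭ perm ∘ [ ∈-++⁺ʳ bL ∘ Equivalence.to (∈-fromList aL x) , ∈-++⁺ˡ ∘ Equivalence.to (B⇔ x) ]′
         ∘ x∈p∪q⁻ A B
    from : ∀ x → x ∈ x₁ ∷ y₁ ∷ a ∷ b ∷ x₂ ∷ y₂ ∷ c ∷ d ∷ [] → x ∈ₛ A ∪ B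
    from x = x∈p∪q⁺ ∘ [ inj₂ ∘ Equivalence.from (B⇔ x) , inj₁ ∘ Equivalence.from (∈-fromList aL x) ]′
           ∘ ∈-++⁻ bL ∘ ∈-resp-↭ (↭-sym perm)

  linkOutside : Subset n → Fin n → Fin n → Subset n
  linkOutside B x y = tabulate (λ v → edge H x y v ∧ not (lookup B v))

  ∈-linkOutside : ∀ {B x y v} → lookup (linkOutside B x y) v ≡ true → edge H x y v ≡ true × v ∉ₛ B
  ∈-linkOutside {B} {x} {y} {v} v∈ =
    let xyv , v∉B = split-∧ (trans (sym (lookup∘tabulate _ v)) v∈)
    in  xyv , λ v∈B → false≢true (trans (sym (not-injective v∉B)) (Equivalence.to ∈ₛ⇔lookup v∈B))

  codeg≤∣linkOutside∣+∣B∣ : ∀ B x y → codeg H x y ≤ ∣ linkOutside B x y ∣ + ∣ B ∣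
  codeg≤∣linkOutside∣+∣B∣ B x y = begin
    codeg H x y
      ≤⟨ ∑-mono (allFin n) (λ v → split (edge H x y v) (lookup B v)) ⟩
    ∑[ v ∈ allFin n ] (𝟙 (edge H x y v ∧ not (lookup B v)) + 𝟙 (lookup B v))
      ≡⟨ ∑-+ _ _ (allFin n) ⟩
    count (λ v → edge H x y v ∧ not (lookup B v)) + count (lookup B)
      ≡⟨ sym (cong₂ _+_ (∣tabulate∣≡count (λ v → edge H x y v ∧ not (lookup B v))) (∣∣≡count B)) ⟩
    ∣ linkOutside B x y ∣ + ∣ B ∣                       ∎
    where
    open ≤-Reasoning
    split : ∀ a b → 𝟙 a ≤ 𝟙 (a ∧ not b) + 𝟙 b
    split true  true  = s≤s z≤n
    split true  false = s≤s z≤n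
    split false _     = z≤n

  module _ {B : Subset n} {x₁ y₁ x₂ y₂ : Fin n}
    (uB : Unique (x₁ ∷ y₁ ∷ x₂ ∷ y₂ ∷ [])) (B⇔ : ∀ x → x ∈ₛ B ⇔ x ∈ (x₁ ∷ y₁ ∷ x₂ ∷ y₂ ∷ [])) where

    open CherryCount H (linkOutside B x₁ y₁) (linkOutside B x₂ y₂) using (isCherry; cherries)

    isCherry⇒absorbs : ∀ q → isCherry q ≡ true → ∣ quadSet q ∣ ≡ 4 × Absorbs H (quadSet q) B
    isCherry⇒absorbs (a , b , c , d) isCherry≡true =
      let spine , rest          = split-∧ isCherry≡true
          a∈link₁ , b∈link₁     = split-∧ spine
          c-leaf , rest′        = split-∧ rest
          d-leaf , c≢d          = split-∧ rest′
          c∈link₂ , abc         = split-∧ c-leaf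
          d∈link₂ , abd         = split-∧ d-leaf
          x₁y₁a , a∉B           = ∈-linkOutside a∈link₁
          x₁y₁b , b∉B           = ∈-linkOutside b∈link₁
          x₂y₂c , c∉B           = ∈-linkOutside c∈link₂
          x₂y₂d , d∉B           = ∈-linkOutside d∈link₂
      in  absorbs uB B⇔ (a∉B ∷ b∉B ∷ c∉B ∷ d∉B ∷ []) (abc , abd) (distinct c≢d) (x₁y₁a , x₁y₁b) (x₂y₂c , x₂y₂d)
      where
      distinct : not (does (c ≟ d)) ≡ true → c ≢ d
      distinct c≢d c≡d = false≢true (trans (cong not (sym (dec-true (c ≟ d) c≡d))) c≢d)

    cherries-absorb : All (λ A → ∣ A ∣ ≡ 4 × Absorbs H A B) (deduplicate _≟ₛ_ (map quadSet cherries))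
    cherries-absorb = All.tabulate λ A∈ →
      case ∈-map⁻ quadSet (∈-deduplicate⁻ _≟ₛ_ (map quadSet cherries) A∈) of λ
        { (q , q∈cherries , refl) → isCherry⇒absorbs q (Equivalence.to T-≡
            (proj₂ (∈-filter⁻ (T? ∘ isCherry) {xs = quadruples (allFin n)} q∈cherries))) }

module Arithmetic where

  open import Data.List using ([]; _∷_)
  open import Data.Nat
  open import Data.Nat.DivMod using (m≡m%n+[m/n]*n; m%n<n)
  open import Data.Nat.Properties
  open import Data.Nat.Tactic.RingSolver using (solve)
  open import Relation.Binary.PropositionalEquality

  m≤2*n*[m/n] : ∀ m n .{{_ : NonZero n}} → 1 ≤ m / n → m ≤ 2 * n * (m / n)
  m≤2*n*[m/n] m n 1≤m/n = begin
    m                          ≡⟨ m≡m%n+[m/n]*n m n ⟩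
    m % n + m / n * n          ≤⟨ +-monoˡ-≤ (m / n * n) (<⇒≤ (m%n<n m n)) ⟩
    n + m / n * n              ≡⟨ cong (_+ m / n * n) (sym (*-identityˡ n)) ⟩
    1 * n + m / n * n          ≤⟨ +-monoˡ-≤ (m / n * n) (*-monoˡ-≤ n 1≤m/n) ⟩
    m / n * n + m / n * n      ≡⟨ double (m / n) ⟩
    2 * n * (m / n)            ∎
    where
    open ≤-Reasoning
    double : ∀ t → t * n + t * n ≡ 2 * n * t
    double t = solve (t ∷ n ∷ [])

  D*t≤s : ∀ d {t n c s} → t * (8 * (suc d * suc d)) ≤ n → n ≤ 4 * suc d * c → c ≤ s + 4 → 4 ≤ t →
    suc d * t ≤ s
  D*t≤s d {t} {n} {c} {s} tK≤n n≤4Dc c≤s+4 4≤t = +-cancelʳ-≤ 4 _ _ (begin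
    suc d * t + 4              ≤⟨ +-monoʳ-≤ (suc d * t) (≤-trans 4≤t (m≤n*m t (suc d))) ⟩
    suc d * t + suc d * t      ≡⟨ solve (d ∷ t ∷ []) ⟩
    2 * (suc d * t)            ≤⟨ 2Dt≤c ⟩
    c                          ≤⟨ c≤s+4 ⟩
    s + 4                      ∎)
    where
    open ≤-Reasoning
    2Dt≤c : 2 * (suc d * t) ≤ c
    2Dt≤c = *-cancelˡ-≤ (4 * suc d) (begin
      4 * suc d * (2 * (suc d * t))  ≡⟨ solve (d ∷ t ∷ []) ⟩
      t * (8 * (suc d * suc d))      ≤⟨ tK≤n ⟩
      n                              ≤⟨ n≤4Dc ⟩
      4 * suc d * c                  ∎)

  cancel-density : ∀ d {M s τ t X N} → M * (s * s * τ) ≤ suc d * M * X + suc d * N → suc d * t ≤ τ →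
    M * (s * s * t) ≤ M * X + N
  cancel-density d {M} {s} {τ} {t} {X} {N} qr Dt≤τ = *-cancelˡ-≤ (suc d) (begin
    suc d * (M * (s * s * t))  ≡⟨ solve (d ∷ M ∷ s ∷ t ∷ []) ⟩
    M * (s * s * (suc d * t))  ≤⟨ *-monoʳ-≤ M (*-monoʳ-≤ (s * s) Dt≤τ) ⟩
    M * (s * s * τ)            ≤⟨ qr ⟩
    suc d * M * X + suc d * N  ≡⟨ solve (d ∷ M ∷ X ∷ N ∷ []) ⟩
    suc d * (M * X + N)        ∎)
    where open ≤-Reasoning

  t⁴≤cherries+error : ∀ {M s t X L N} → M * (s * s * t) ≤ M * X + N → 2 * t * X ≤ L + X + t * t * (s * s) →
    X ≤ N → t ≤ s → M * (t * t * (t * t)) ≤ M * L + (M + 2 * t) * N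
  t⁴≤cherries+error {M} {s} {t} {X} {L} {N} density cherries X≤N t≤s = begin
    M * (t * t * (t * t))      ≤⟨ *-monoʳ-≤ M (*-monoʳ-≤ (t * t) (*-mono-≤ t≤s t≤s)) ⟩
    M * (t * t * (s * s))      ≤⟨ +-cancelʳ-≤ _ _ _ twice ⟩
    M * L + M * X + 2 * t * N  ≤⟨ +-monoˡ-≤ (2 * t * N) (+-monoʳ-≤ (M * L) (*-monoʳ-≤ M X≤N)) ⟩
    M * L + M * N + 2 * t * N  ≡⟨ solve (M ∷ L ∷ N ∷ t ∷ []) ⟩
    M * L + (M + 2 * t) * N    ∎
    where
    open ≤-Reasoning
    twice : M * (t * t * (s * s)) + M * (t * t * (s * s)) ≤ M * L + M * X + 2 * t * N + M * (t * t * (s * s))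
    twice = begin
      M * (t * t * (s * s)) + M * (t * t * (s * s))      ≡⟨ solve (M ∷ s ∷ t ∷ []) ⟩
      2 * t * (M * (s * s * t))                          ≤⟨ *-monoʳ-≤ (2 * t) density ⟩
      2 * t * (M * X + N)                                ≡⟨ solve (t ∷ M ∷ X ∷ N ∷ []) ⟩
      M * (2 * t * X) + 2 * t * N                        ≤⟨ +-monoˡ-≤ (2 * t * N) (*-monoʳ-≤ M cherries) ⟩
      M * (L + X + t * t * (s * s)) + 2 * t * N          ≡⟨ solve (M ∷ L ∷ X ∷ t ∷ s ∷ N ∷ []) ⟩
      M * L + M * X + 2 * t * N + M * (t * t * (s * s))  ∎

  2*error≤M*t⁴ : ∀ {M t Q N} → N ≤ Q * Q * Q * (t * t * t) → 4 * (Q * Q * Q) ≤ t → 8 * (Q * Q * Q) ≤ M →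
    2 * ((M + 2 * t) * N) ≤ M * (t * t * (t * t))
  2*error≤M*t⁴ {M} {t} {Q} {N} N≤Q³t³ 4Q³≤t 8Q³≤M = begin
    2 * ((M + 2 * t) * N)                                  ≤⟨ *-monoʳ-≤ 2 (*-monoʳ-≤ (M + 2 * t) N≤Q³t³) ⟩
    2 * ((M + 2 * t) * (Q * Q * Q * (t * t * t)))          ≡⟨ solve (M ∷ t ∷ Q ∷ []) ⟩
    (2 * M * (Q * Q * Q) + 4 * t * (Q * Q * Q)) * (t * t * t)  ≤⟨ *-monoˡ-≤ (t * t * t) coefficient ⟩
    M * t * (t * t * t)                                    ≡⟨ solve (M ∷ t ∷ []) ⟩
    M * (t * t * (t * t))                                  ∎
    where
    open ≤-Reasoning
    coefficient : 2 * M * (Q * Q * Q) + 4 * t * (Q * Q * Q) ≤ M * t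
    coefficient = *-cancelˡ-≤ 2 (begin
      2 * (2 * M * (Q * Q * Q) + 4 * t * (Q * Q * Q))  ≡⟨ solve (M ∷ t ∷ Q ∷ []) ⟩
      M * (4 * (Q * Q * Q)) + t * (8 * (Q * Q * Q))    ≤⟨ +-mono-≤ (*-monoʳ-≤ M 4Q³≤t) (*-monoʳ-≤ t 8Q³≤M) ⟩
      M * t + t * M                                    ≡⟨ solve (M ∷ t ∷ []) ⟩
      2 * (M * t)                                      ∎)

  t⁴≤2*L : ∀ m {t L E} → suc m * (t * t * (t * t)) ≤ suc m * L + E → 2 * E ≤ suc m * (t * t * (t * t)) →
    t * t * (t * t) ≤ 2 * L
  t⁴≤2*L m {t} {L} {E} main error = *-cancelˡ-≤ (suc m) (+-cancelʳ-≤ _ _ _ (begin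
    suc m * (t * t * (t * t)) + suc m * (t * t * (t * t))  ≡⟨ solve (m ∷ t ∷ []) ⟩
    2 * (suc m * (t * t * (t * t)))                        ≤⟨ *-monoʳ-≤ 2 main ⟩
    2 * (suc m * L + E)                                    ≡⟨ solve (m ∷ L ∷ E ∷ []) ⟩
    suc m * (2 * L) + 2 * E                                ≤⟨ +-monoʳ-≤ (suc m * (2 * L)) error ⟩
    suc m * (2 * L) + suc m * (t * t * (t * t))            ∎))
    where open ≤-Reasoning

  -- Powers n ^ k enter the chains in their unfolded form n * (… * (n * 1)), which the ring solver reads.
  n³≤Q³t³ : ∀ {n Q t} → n ≤ Q * t → n ^ 3 ≤ Q * Q * Q * (t * t * t)
  n³≤Q³t³ {n} {Q} {t} n≤Qt = begin
    n * (n * (n * 1))            ≡⟨ solve (n ∷ []) ⟩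
    n * n * n                    ≤⟨ *-mono-≤ (*-mono-≤ n≤Qt n≤Qt) n≤Qt ⟩
    Q * t * (Q * t) * (Q * t)    ≡⟨ solve (Q ∷ t ∷ []) ⟩
    Q * Q * Q * (t * t * t)      ∎
    where open ≤-Reasoning

  n⁴≤512*Q⁴*A : ∀ {n Q t L A} → n ≤ Q * t → t * t * (t * t) ≤ 2 * L → L ≤ A * 256 →
    n ^ 4 ≤ 512 * (Q * Q * (Q * Q)) * A
  n⁴≤512*Q⁴*A {n} {Q} {t} {L} {A} n≤Qt t⁴≤2L L≤256A = begin
    n * (n * (n * (n * 1)))              ≡⟨ solve (n ∷ []) ⟩
    n * n * (n * n)                      ≤⟨ *-mono-≤ (*-mono-≤ n≤Qt n≤Qt) (*-mono-≤ n≤Qt n≤Qt) ⟩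
    Q * t * (Q * t) * (Q * t * (Q * t))  ≡⟨ solve (Q ∷ t ∷ []) ⟩
    Q * Q * (Q * Q) * (t * t * (t * t))  ≤⟨ *-monoʳ-≤ (Q * Q * (Q * Q)) (≤-trans t⁴≤2L (*-monoʳ-≤ 2 L≤256A)) ⟩
    Q * Q * (Q * Q) * (2 * (A * 256))    ≡⟨ solve (Q ∷ A ∷ []) ⟩
    512 * (Q * Q * (Q * Q)) * A          ∎
    where open ≤-Reasoning

module RationalBounds where

  open import Data.Integer as ℤ using (+_; +0; +[1+_]; -[1+_])
  import Data.Integer.Properties as ℤ
  open import Data.Nat as ℕ using (zero; suc)
  import Data.Nat.Properties as ℕ
  open import Data.Nat.Coprimality using (1-coprimeTo) renaming (sym to coprime-sym)
  open import Data.Product using (∃; _×_; _,_)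
  open import Data.Rational
  open import Data.Rational.Properties
  import Data.Rational.Unnormalised as ℚᵘ
  import Data.Rational.Unnormalised.Properties as ℚᵘ
  open import Data.Rational.Solver using (module +-*-Solver)
  open import Relation.Binary.PropositionalEquality
  open import Relation.Nullary using (contradiction)
  open +-*-Solver

  toℚ-mkℚ : ∀ m → toℚ m ≡ mkℚ (+ m) 0 (coprime-sym (1-coprimeTo m))
  toℚ-mkℚ m = normalize-coprime (coprime-sym (1-coprimeTo m))

  toℚ-suc : ∀ m → toℚ (suc m) ≡ 1ℚ + toℚ m
  toℚ-suc m rewrite toℚ-mkℚ m = cong (_/ 1) (sym (cong (ℤ._+_ (+ 1)) (ℤ.*-identityʳ (+ m))))

  toℚ-+ : ∀ m k → toℚ (m ℕ.+ k) ≡ toℚ m + toℚ k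
  toℚ-+ zero    k = sym (+-identityˡ (toℚ k))
  toℚ-+ (suc m) k = begin
    toℚ (suc m ℕ.+ k)        ≡⟨ toℚ-suc (m ℕ.+ k) ⟩
    1ℚ + toℚ (m ℕ.+ k)       ≡⟨ cong (_+_ 1ℚ) (toℚ-+ m k) ⟩
    1ℚ + (toℚ m + toℚ k)     ≡⟨ sym (+-assoc 1ℚ (toℚ m) (toℚ k)) ⟩
    1ℚ + toℚ m + toℚ k       ≡⟨ cong (_+ toℚ k) (sym (toℚ-suc m)) ⟩
    toℚ (suc m) + toℚ k      ∎
    where open ≡-Reasoning

  toℚ-* : ∀ m k → toℚ (m ℕ.* k) ≡ toℚ m * toℚ k
  toℚ-* zero    k = sym (*-zeroˡ (toℚ k))
  toℚ-* (suc m) k = begin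
    toℚ (k ℕ.+ m ℕ.* k)           ≡⟨ toℚ-+ k (m ℕ.* k) ⟩
    toℚ k + toℚ (m ℕ.* k)         ≡⟨ cong (_+_ (toℚ k)) (toℚ-* m k) ⟩
    toℚ k + toℚ m * toℚ k         ≡⟨ solve 2 (λ m k → k :+ m :* k := (con 1ℚ :+ m) :* k) refl (toℚ m) (toℚ k) ⟩
    (1ℚ + toℚ m) * toℚ k          ≡⟨ cong (_* toℚ k) (sym (toℚ-suc m)) ⟩
    toℚ (suc m) * toℚ k           ∎
    where open ≡-Reasoning

  toℚ-mono-≤ : ∀ {m k} → m ℕ.≤ k → toℚ m ≤ toℚ k
  toℚ-mono-≤ {m} {k} m≤k rewrite toℚ-mkℚ m | toℚ-mkℚ k =
    *≤* (subst₂ ℤ._≤_ (sym (ℤ.*-identityʳ (+ m))) (sym (ℤ.*-identityʳ (+ k))) (ℤ.+≤+ m≤k))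

  toℚ-cancel-≤ : ∀ {m k} → toℚ m ≤ toℚ k → m ℕ.≤ k
  toℚ-cancel-≤ {m} {k} m≤k rewrite toℚ-mkℚ m | toℚ-mkℚ k =
    ℤ.drop‿+≤+ (subst₂ ℤ._≤_ (ℤ.*-identityʳ (+ m)) (ℤ.*-identityʳ (+ k)) (drop-*≤* m≤k))

  toℚ-nonNeg : ∀ m → NonNegative (toℚ m)
  toℚ-nonNeg m = subst NonNegative (sym (toℚ-mkℚ m)) _

  toℚ*toℚ-nonNeg : ∀ m k → NonNegative (toℚ m * toℚ k)
  toℚ*toℚ-nonNeg m k = subst NonNegative (toℚ-* m k) (toℚ-nonNeg (m ℕ.* k))

  archimedean : ∀ p → 0ℚ < p → ∃ λ d → 1ℚ ≤ p * toℚ (suc d)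
  archimedean p@(mkℚ +[1+ k ] d _) _ =
    d , toℚᵘ-cancel-≤ (ℚᵘ.≤-respʳ-≃ (ℚᵘ.≃-sym (toℚᵘ-homo-* p (toℚ (suc d)))) bound)
    where
    bound : toℚᵘ 1ℚ ℚᵘ.≤ toℚᵘ p ℚᵘ.* toℚᵘ (toℚ (suc d))
    bound rewrite toℚ-mkℚ (suc d) = ℚᵘ.*≤* (subst₂ ℤ._≤_
      (sym (trans (ℤ.*-identityˡ _) (trans (ℚᵘ.↧[n/d]≡d (+[1+ k ] ℤ.* + suc d) (suc d ℕ.* 1))
                                           (cong +_ (ℕ.*-identityʳ (suc d))))))
      (sym (trans (ℤ.*-identityʳ _) (trans (ℚᵘ.↥[n/d]≡n (+[1+ k ] ℤ.* + suc d) (suc d ℕ.* 1))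
                                           (sym (ℤ.pos-* (suc k) (suc d))))))
      (ℤ.+≤+ (ℕ.m≤n*m (suc d) (suc k))))
  archimedean (mkℚ +0       _ _) 0<0  = contradiction 0<0 (<-irrefl (sym (↥p≡0⇒p≡0 _ refl)))
  archimedean (mkℚ -[1+ _ ] _ _) 0<p  = contradiction 0<p (<-asym (negative⁻¹ _))

  reciprocal : ℕ → ℚ
  reciprocal m = 1/ mkℚ +[1+ m ] 0 (coprime-sym (1-coprimeTo (suc m)))

  reciprocal-inverse : ∀ m → reciprocal m * toℚ (suc m) ≡ 1ℚ
  reciprocal-inverse m rewrite toℚ-mkℚ (suc m) = *-inverseˡ (mkℚ +[1+ m ] 0 (coprime-sym (1-coprimeTo (suc m))))

  reciprocal-pos : ∀ m → 0ℚ < reciprocal m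
  reciprocal-pos m = positive⁻¹ (reciprocal m)

  codegree⇒ℕ : ∀ {r} D {n c} → 1ℚ ≤ r * toℚ D → r * (+ 1 / 4) * toℚ n ≤ toℚ c → n ℕ.≤ 4 ℕ.* D ℕ.* c
  codegree⇒ℕ {r} D {n} {c} 1≤rD large = toℚ-cancel-≤ (begin
    toℚ n                                         ≡⟨ sym (*-identityˡ (toℚ n)) ⟩
    1ℚ * toℚ n                                    ≤⟨ *-monoʳ-≤-nonNeg (toℚ n) {{toℚ-nonNeg n}} 1≤rD ⟩
    r * toℚ D * toℚ n                             ≡⟨ sym (*-identityʳ _) ⟩
    r * toℚ D * toℚ n * 1ℚ                        ≡⟨ cong (r * toℚ D * toℚ n *_) four*quarter ⟩
    r * toℚ D * toℚ n * (toℚ 4 * (+ 1 / 4))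
      ≡⟨ solve 5 (λ r D n F q → r :* D :* n :* (F :* q) := F :* D :* (r :* q :* n)) refl
           r (toℚ D) (toℚ n) (toℚ 4) (+ 1 / 4) ⟩
    toℚ 4 * toℚ D * (r * (+ 1 / 4) * toℚ n)       ≤⟨ *-monoˡ-≤-nonNeg (toℚ 4 * toℚ D) {{toℚ*toℚ-nonNeg 4 D}} large ⟩
    toℚ 4 * toℚ D * toℚ c                         ≡⟨ sym (trans (toℚ-* (4 ℕ.* D) c) (cong (_* toℚ c) (toℚ-* 4 D))) ⟩
    toℚ (4 ℕ.* D ℕ.* c)                           ∎)
    where
    open ≤-Reasoning
    four*quarter : 1ℚ ≡ toℚ 4 * (+ 1 / 4)
    four*quarter = refl

  density⇒ℕ : ∀ {p μ} D M {a N X} → 1ℚ ≤ p * toℚ D → μ * toℚ M ≡ 1ℚ → p * toℚ a - μ * toℚ N ≤ toℚ X →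
    M ℕ.* a ℕ.≤ D ℕ.* M ℕ.* X ℕ.+ D ℕ.* N
  density⇒ℕ {p} {μ} D M {a} {N} {X} 1≤pD μM≡1 density = toℚ-cancel-≤ (begin
    toℚ (M ℕ.* a)                                  ≡⟨ toℚ-* M a ⟩
    toℚ M * toℚ a                                  ≡⟨ sym (*-identityʳ _) ⟩
    toℚ M * toℚ a * 1ℚ                             ≤⟨ *-monoˡ-≤-nonNeg (toℚ M * toℚ a) {{toℚ*toℚ-nonNeg M a}} 1≤pD ⟩
    toℚ M * toℚ a * (p * toℚ D)
      ≡⟨ solve 6 (λ p D M a N μ → M :* a :* (p :* D) := D :* M :* (p :* a :- μ :* N :+ μ :* N)) refl
           p (toℚ D) (toℚ M) (toℚ a) (toℚ N) μ ⟩
    toℚ D * toℚ M * (p * toℚ a - μ * toℚ N + μ * toℚ N)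
      ≤⟨ *-monoˡ-≤-nonNeg (toℚ D * toℚ M) {{toℚ*toℚ-nonNeg D M}} (+-monoˡ-≤ (μ * toℚ N) density) ⟩
    toℚ D * toℚ M * (toℚ X + μ * toℚ N)
      ≡⟨ solve 5 (λ D M N μ X → D :* M :* (X :+ μ :* N) := D :* M :* X :+ D :* N :* (μ :* M)) refl
           (toℚ D) (toℚ M) (toℚ N) μ (toℚ X) ⟩
    toℚ D * toℚ M * toℚ X + toℚ D * toℚ N * (μ * toℚ M)
      ≡⟨ cong (λ z → toℚ D * toℚ M * toℚ X + toℚ D * toℚ N * z) μM≡1 ⟩
    toℚ D * toℚ M * toℚ X + toℚ D * toℚ N * 1ℚ
      ≡⟨ cong (λ z → toℚ D * toℚ M * toℚ X + z) (*-identityʳ _) ⟩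
    toℚ D * toℚ M * toℚ X + toℚ D * toℚ N
      ≡⟨ sym (trans (toℚ-+ (D ℕ.* M ℕ.* X) (D ℕ.* N))
               (cong₂ _+_ (trans (toℚ-* (D ℕ.* M) X) (cong (_* toℚ X) (toℚ-* D M))) (toℚ-* D N))) ⟩
    toℚ (D ℕ.* M ℕ.* X ℕ.+ D ℕ.* N)                ∎)
    where open ≤-Reasoning

  reciprocal*≤ : ∀ m {N L} → N ℕ.≤ suc m ℕ.* L → reciprocal m * toℚ N ≤ toℚ L
  reciprocal*≤ m {N} {L} N≤[1+m]L = begin
    reciprocal m * toℚ N                       ≤⟨ *-monoˡ-≤-nonNeg (reciprocal m) {{pos⇒nonNeg (reciprocal m)}}
                                                    (toℚ-mono-≤ N≤[1+m]L) ⟩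
    reciprocal m * toℚ (suc m ℕ.* L)           ≡⟨ cong (reciprocal m *_) (toℚ-* (suc m) L) ⟩
    reciprocal m * (toℚ (suc m) * toℚ L)       ≡⟨ sym (*-assoc (reciprocal m) (toℚ (suc m)) (toℚ L)) ⟩
    reciprocal m * toℚ (suc m) * toℚ L         ≡⟨ cong (_* toℚ L) (reciprocal-inverse m) ⟩
    1ℚ * toℚ L                                 ≡⟨ *-identityˡ (toℚ L) ⟩
    toℚ L                                      ∎
    where open ≤-Reasoning

  common-bound : ∀ p α → 0ℚ < p → 0ℚ < α → ∃ λ d → 1ℚ ≤ p * toℚ (suc d) × 1ℚ ≤ (p ⊓ α) * toℚ (suc d)
  common-bound p α 0<p 0<α with archimedean p 0<p | archimedean α 0<α
  ... | dₚ , 1≤pDₚ | dₐ , 1≤αDₐ =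
    d , 1≤pD , ≤-trans (⊓-glb 1≤pD 1≤αD) (≤-reflexive (sym (*-distribʳ-⊓-nonNeg D p α)))
    where
    -- suc d = suc dₚ * suc dₐ
    d = dₐ ℕ.+ dₚ ℕ.* suc dₐ
    D = toℚ (suc d)
    instance
      D-nonNeg : NonNegative D
      D-nonNeg = toℚ-nonNeg (suc d)
    1≤pD : 1ℚ ≤ p * D
    1≤pD = ≤-trans 1≤pDₚ (*-monoˡ-≤-nonNeg p {{nonNegative (<⇒≤ 0<p)}} (toℚ-mono-≤ (ℕ.m≤m*n (suc dₚ) (suc dₐ))))
    1≤αD : 1ℚ ≤ α * D
    1≤αD = ≤-trans 1≤αDₐ (*-monoˡ-≤-nonNeg α {{nonNegative (<⇒≤ 0<α)}} (toℚ-mono-≤ (ℕ.m≤n*m (suc dₐ) (suc dₚ))))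

-- D = d + 1 satisfies 1 ≤ ζD, and t = ⌊n/K⌋ is the scale of the argument: the links of the two pairs of
-- B outside B have at least Dt vertices, and n ≤ Qt.  Then μ⁻¹ = 8Q³ + 1 together with t ≥ 4Q³ makes
-- the error μn³ of quasirandomness negligible, and ε⁻¹ = 512Q⁴ + 1 accounts for
-- n⁴ ≤ Q⁴t⁴ ≤ 2Q⁴·#quadruples ≤ 512Q⁴·#absorbers.
module Constants (d : ℕ) where

  open import Data.Nat
  open import Data.Nat.DivMod using (m*n/n≡m; m/n*n≤m; /-monoˡ-≤)
  open import Data.Nat.Properties
  open import Data.Rational as ℚ using (ℚ; 0ℚ)
  open import Relation.Binary.PropositionalEquality using (sym)
  open Arithmetic using (m≤2*n*[m/n])
  open RationalBounds using (reciprocal; reciprocal-pos)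

  K Q n₀ : ℕ
  K  = 8 * (suc d * suc d)
  Q  = 2 * K
  n₀ = (4 * (Q * Q * Q) + 4) * K

  μ ε : ℚ
  μ = reciprocal (8 * (Q * Q * Q))
  ε = reciprocal (512 * (Q * Q * (Q * Q)))

  0<μ : 0ℚ ℚ.< μ
  0<μ = reciprocal-pos (8 * (Q * Q * Q))

  0<ε : 0ℚ ℚ.< ε
  0<ε = reciprocal-pos (512 * (Q * Q * (Q * Q)))

  module Scale {n : ℕ} (n₀≤n : n₀ ≤ n) where

    t : ℕ
    t = n / K

    4Q³+4≤t : 4 * (Q * Q * Q) + 4 ≤ t
    4Q³+4≤t = ≤-trans (≤-reflexive (sym (m*n/n≡m (4 * (Q * Q * Q) + 4) K))) (/-monoˡ-≤ K n₀≤n)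

    4Q³≤t : 4 * (Q * Q * Q) ≤ t
    4Q³≤t = ≤-trans (m≤m+n (4 * (Q * Q * Q)) 4) 4Q³+4≤t

    4≤t : 4 ≤ t
    4≤t = ≤-trans (m≤n+m 4 (4 * (Q * Q * Q))) 4Q³+4≤t

    t*K≤n : t * K ≤ n
    t*K≤n = m/n*n≤m n K

    n≤Q*t : n ≤ Q * t
    n≤Q*t = m≤2*n*[m/n] n K (≤-trans (s≤s z≤n) 4≤t)

open import Data.Fin using (Fin)
open import Data.Fin.Subset using (Subset; ∣_∣) renaming (_∈_ to _∈ₛ_)
open import Data.Integer using (+_)
open import Data.List using ([]; _∷_; map; length; deduplicate)
open import Data.List.Membership.Propositional using (_∈_)
open import Data.List.Relation.Unary.All using ([]; _∷_)
open import Data.List.Relation.Unary.Unique.Propositional using (Unique)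
open import Data.List.Relation.Unary.Unique.DecPropositional.Properties using (deduplicate-!)
import Data.Nat as ℕ
import Data.Nat.Properties as ℕ
open import Data.Rational using (ℚ; 0ℚ; 1ℚ; _/_; _*_; _<_; _⊓_; _≤_; _-_)
open import Data.Product using (_×_; _,_; ∃-syntax)
open import Function using (_∘_; _⇔_)
open import Relation.Binary.PropositionalEquality using (_≡_; sym; trans; subst)
open import Relation.Nullary using (contradiction)
open Subsets using (∣∣≡length)
open Arithmetic using (D*t≤s; cancel-density; t⁴≤cherries+error; 2*error≤M*t⁴; t⁴≤2*L; n³≤Q³t³; n⁴≤512*Q⁴*A)
open RationalBounds using (reciprocal-inverse; codegree⇒ℕ; density⇒ℕ; reciprocal*≤; common-bound)
open Counting using (module CherryCount; length≤images*k; quadruples)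

-- Implicit arguments are passed by name below: left to unification, the constants of Constants would be
-- normalised to enormous unary terms.
module AbsorberBound {p ζ : ℚ} (d : ℕ) (1≤pD : 1ℚ ≤ p * toℚ (ℕ.suc d)) (1≤ζD : 1ℚ ≤ ζ * toℚ (ℕ.suc d))
  {n : ℕ} (H : ThreeGraph n) (n₀≤n : Constants.n₀ d ℕ.≤ n)
  (quasirandom : ∀ X₁ X₂ X₃ →
    p * toℚ (∣ X₁ ∣ ℕ.* ∣ X₂ ∣ ℕ.* ∣ X₃ ∣) - Constants.μ d * toℚ (n ℕ.^ 3) ≤ toℚ (e H X₁ X₂ X₃))
  {B : Subset n} (∣B∣≡4 : ∣ B ∣ ≡ 4) where

  open Constants d
  open Scale n₀≤n
  open Absorption H

  link-large : ∀ {x y} → ζ * (+ 1 / 4) * toℚ n ≤ toℚ (codeg H x y) → ℕ.suc d ℕ.* t ℕ.≤ ∣ linkOutside B x y ∣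
  link-large {x} {y} large = D*t≤s d {t = t} {n = n} {c = codeg H x y} {s = ∣ linkOutside B x y ∣} t*K≤n
    (codegree⇒ℕ {r = ζ} (ℕ.suc d) {n = n} {c = codeg H x y} 1≤ζD large)
    (subst (λ b → codeg H x y ℕ.≤ ∣ linkOutside B x y ∣ ℕ.+ b) ∣B∣≡4 (codeg≤∣linkOutside∣+∣B∣ B x y)) 4≤t

  module _ {x₁ y₁ x₂ y₂ : Fin n}
    (uB : Unique (x₁ ∷ y₁ ∷ x₂ ∷ y₂ ∷ [])) (B⇔ : ∀ x → x ∈ₛ B ⇔ x ∈ (x₁ ∷ y₁ ∷ x₂ ∷ y₂ ∷ []))
    (large₁ : ζ * (+ 1 / 4) * toℚ n ≤ toℚ (codeg H x₁ y₁)) (large₂ : ζ * (+ 1 / 4) * toℚ n ≤ toℚ (codeg H x₂ y₂))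
    where

    S T : Subset n
    S = linkOutside B x₁ y₁
    T = linkOutside B x₂ y₂

    open CherryCount H S T

    t⁴≤2*∣cherries∣ : t ℕ.* t ℕ.* (t ℕ.* t) ℕ.≤ 2 ℕ.* length cherries
    t⁴≤2*∣cherries∣ = t⁴≤2*L m {t = t} {L = length cherries} {E = (M ℕ.+ 2 ℕ.* t) ℕ.* n ℕ.^ 3} main error
      where
      m = 8 ℕ.* (Q ℕ.* Q ℕ.* Q)
      M = ℕ.suc m
      density : M ℕ.* (∣ S ∣ ℕ.* ∣ S ∣ ℕ.* t) ℕ.≤ M ℕ.* edgesSST ℕ.+ n ℕ.^ 3
      density = subst (λ X → M ℕ.* (∣ S ∣ ℕ.* ∣ S ∣ ℕ.* t) ℕ.≤ M ℕ.* X ℕ.+ n ℕ.^ 3) e≡edgesSST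
        (cancel-density d {M = M} {s = ∣ S ∣} {τ = ∣ T ∣} {t = t} {X = e H S S T} {N = n ℕ.^ 3}
          (density⇒ℕ {p = p} {μ = μ} (ℕ.suc d) M {a = ∣ S ∣ ℕ.* ∣ S ∣ ℕ.* ∣ T ∣} {N = n ℕ.^ 3} {X = e H S S T}
            1≤pD (reciprocal-inverse m) (quasirandom S S T))
          (link-large large₂))
      main : M ℕ.* (t ℕ.* t ℕ.* (t ℕ.* t)) ℕ.≤ M ℕ.* length cherries ℕ.+ (M ℕ.+ 2 ℕ.* t) ℕ.* n ℕ.^ 3
      main = t⁴≤cherries+error {M = M} {s = ∣ S ∣} {t = t} {X = edgesSST} {L = length cherries} {N = n ℕ.^ 3}
        density (cherry-count t) edgesSST≤n³ (ℕ.≤-trans (ℕ.m≤n*m t (ℕ.suc d)) (link-large large₁))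
      error : 2 ℕ.* ((M ℕ.+ 2 ℕ.* t) ℕ.* n ℕ.^ 3) ℕ.≤ M ℕ.* (t ℕ.* t ℕ.* (t ℕ.* t))
      error = 2*error≤M*t⁴ {M = M} {t = t} {Q = Q} {N = n ℕ.^ 3}
        (n³≤Q³t³ {n = n} {Q = Q} {t = t} n≤Q*t) 4Q³≤t (ℕ.n≤1+n m)

    many-absorbers : ManyAbsorbers H ε B
    many-absorbers = absorbers , deduplicate-! _≟ₛ_ (map quadSet cherries) , cherries-absorb uB B⇔
      , reciprocal*≤ k {N = n ℕ.^ 4} {L = length absorbers}
          (ℕ.≤-trans n⁴≤ (ℕ.*-monoˡ-≤ (length absorbers) (ℕ.n≤1+n k)))
      where
      k = 512 ℕ.* (Q ℕ.* Q ℕ.* (Q ℕ.* Q))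
      absorbers = deduplicate _≟ₛ_ (map quadSet cherries)
      ∣cherries∣≤256*∣absorbers∣ : length cherries ℕ.≤ length absorbers ℕ.* 256
      ∣cherries∣≤256*∣absorbers∣ = length≤images*k _≟q_ _≟ₛ_ quadSet (quadruples ∘ quadVertices) 256
        cherries-unique quadSet≡⇒∈quadruples (ℕ.≤-reflexive ∘ length-quadruples-quadVertices)
      n⁴≤ : n ℕ.^ 4 ℕ.≤ k ℕ.* length absorbers
      n⁴≤ = n⁴≤512*Q⁴*A {n = n} {Q = Q} {t = t} {L = length cherries} {A = length absorbers}
        n≤Q*t t⁴≤2*∣cherries∣ ∣cherries∣≤256*∣absorbers∣

lemma3p1 : ∀ (p α : ℚ) → 0ℚ < p → p < 1ℚ → 0ℚ < α → α < 1ℚ →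
    ∃[ n₀ ] ∃[ ε ] ∃[ μ ] (0ℚ < ε) × (0ℚ < μ) ×
    (∀ (n : ℕ) (H : ThreeGraph n) → n₀ Data.Nat.≤ n → IsQuasiRandom H p μ α →
    ∀ (B : Subset n) → ∣ B ∣ ≡ 4 → Separable H ((p ⊓ α) * (+ 1 / 4)) B →
    ManyAbsorbers H ε B)
lemma3p1 p α 0<p _ 0<α _ with common-bound p α 0<p 0<α
... | d , 1≤pD , 1≤ζD = n₀ , ε , μ , 0<ε , 0<μ , absorbers
  where
  open Constants d
  length≡4 : ∀ {n} {B : Subset n} {L} → Unique L → (∀ x → x ∈ₛ B ⇔ x ∈ L) → ∣ B ∣ ≡ 4 → length L ≡ 4
  length≡4 u B⇔ ∣B∣≡4 = trans (sym (∣∣≡length u B⇔)) ∣B∣≡4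
  absorbers : ∀ (n : ℕ) (H : ThreeGraph n) → n₀ ℕ.≤ n → IsQuasiRandom H p μ α →
    ∀ (B : Subset n) → ∣ B ∣ ≡ 4 → Separable H ((p ⊓ α) * (+ 1 / 4)) B → ManyAbsorbers H ε B
  absorbers n H n₀≤n (quasirandom , _) B ∣B∣≡4 (((x₁ , y₁) ∷ (x₂ , y₂) ∷ []) , u , B⇔ , large₁ ∷ large₂ ∷ []) =
    AbsorberBound.many-absorbers {p = p} {ζ = p ⊓ α} d 1≤pD 1≤ζD H n₀≤n quasirandom ∣B∣≡4 u B⇔ large₁ large₂
  absorbers _ _ _ _ _ ∣B∣≡4 ([] , u , B⇔ , _) =
    contradiction (length≡4 u B⇔ ∣B∣≡4) λ ()
  absorbers _ _ _ _ _ ∣B∣≡4 (((_ , _) ∷ []) , u , B⇔ , _) =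
    contradiction (length≡4 u B⇔ ∣B∣≡4) λ ()
  absorbers _ _ _ _ _ ∣B∣≡4 (((_ , _) ∷ (_ , _) ∷ (_ , _) ∷ _) , u , B⇔ , _) =
    contradiction (length≡4 u B⇔ ∣B∣≡4) λ ()
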